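{- Let $G=(V,E)$ be a finite simple graph and let $\mathcal{F}$ be a (possibly empty) collection of minimal forts of $G$. Consider the integer program $\mathrm{MFF}(G,\mathcal{F})$: minimize $\sum_{v\in V}x_v$ subject to $x\in\{0,1\}^V$, $\sum_{v\in V}x_v\ge1$, $x_u-x_v+\sum_{w\in N(u)\setminus\{v\}}x_w\ge0$ for all $v\in V$, $u\in N(v)$, and $\sum_{v\in F}x_v\le|F|-1$ for all $F\in\mathcal{F}$. Suppose $\mathrm{MFF}(G,\mathcal{F})$ is feasible, let $x$ be an optimal solution, and let $F'=\{v\in V: x_v=1\}$. Then $\mathcal{F}\cup\{F'\}$ is a collection of minimal forts of $G$.
   Context: $N(u)$ is the neighborhood of $u$. A fort of $G$ is a non-empty set $F\subseteq V$ such that no vertex $u\in V\setminus F$ has exactly one neighbor in $F$. A fort is minimal if no fort of $G$ is a proper subset of it. -}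

module Defs where

open import Data.Nat using (ℕ; zero; suc; _+_; _≤_)
open import Data.Bool using (Bool; true; false; _∧_; not; if_then_else_)
open import Data.Fin using (Fin; _≟_)
open import Data.Fin.Subset using (Subset; _∈_; _∉_; _⊂_; Nonempty; ∣_∣)
open import Data.List using (List; _∷_)
open import Data.List.Relation.Unary.All using (All)
open import Data.Product using (_×_)
open import Relation.Binary.PropositionalEquality using (_≡_; _≢_)
open import Relation.Nullary using (¬_)
open import Relation.Nullary.Decidable using (⌊_⌋)

record Graph (n : ℕ) : Set where
  field
    adj   : Fin n → Fin n → Bool
    sym   : ∀ u v → adj u v ≡ adj v u
    irrefl : ∀ v → adj v v ≡ false
open Graph public

sumFin : ∀ {n} → (Fin n → ℕ) → ℕ
sumFin {zero} f = 0
sumFin {suc n} f = f Fin.zero + sumFin {n} (λ i → f (Fin.suc i))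

[_] : Bool → ℕ
[ b ] = if b then 1 else 0

_∈ᵇ_ : ∀ {n} → Fin n → Subset n → Bool
v ∈ᵇ S = Data.Vec.lookup S v
  where import Data.Vec

nbrCount : ∀ {n} → Graph n → Fin n → Subset n → ℕ
nbrCount G u F = sumFin (λ w → [ adj G u w ∧ (w ∈ᵇ F) ])

IsFort : ∀ {n} → Graph n → Subset n → Set
IsFort G F = Nonempty F × (∀ u → u ∉ F → nbrCount G u F ≢ 1)

IsMinimalFort : ∀ {n} → Graph n → Subset n → Set
IsMinimalFort G F = IsFort G F × (∀ F′ → F′ ⊂ F → ¬ IsFort G F′)

Binary : ∀ {n} → (Fin n → ℕ) → Set
Binary x = ∀ v → x v ≤ 1

sumOver : ∀ {n} → Subset n → (Fin n → ℕ) → ℕ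
sumOver F x = sumFin (λ v → if v ∈ᵇ F then x v else 0)

nbrSumExcept : ∀ {n} → Graph n → (Fin n → ℕ) → Fin n → Fin n → ℕ
nbrSumExcept G x u v =
  sumFin (λ w → if adj G u w ∧ not ⌊ w ≟ v ⌋ then x w else 0)

-- Feasibility.  The constraint x_u - x_v + Σ_{w∈N(u)\{v}} x_w ≥ 0 is written
-- over ℕ as x_v ≤ x_u + Σ ...; and Σ_{v∈F} x_v ≤ |F| - 1 as Σ_{v∈F} x_v + 1 ≤ |F|.
Feasible : ∀ {n} → Graph n → List (Subset n) → (Fin n → ℕ) → Set
Feasible G 𝓕 x =
  Binary x
  × 1 ≤ sumFin x
  × (∀ v u → adj G v u ≡ true → x v ≤ x u + nbrSumExcept G x u v)
  × All (λ F → sumOver F x + 1 ≤ ∣ F ∣) 𝓕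

Optimal : ∀ {n} → Graph n → List (Subset n) → (Fin n → ℕ) → Set
Optimal G 𝓕 x = Feasible G 𝓕 x × (∀ y → Feasible G 𝓕 y → sumFin x ≤ sumFin y)

support : ∀ {n} → (Fin n → ℕ) → Subset n
support {n} x = Data.Vec.tabulate (λ v → ⌊ x v Data.Nat.≟ 1 ⌋)
  where import Data.Vec
        import Data.Nat

-- For a 0/1 vector x with support S, the edge constraints
-- x_v ≤ x_u + Σ_{w ∈ N(u) ∖ {v}} x_w say exactly that no vertex u outside S has
-- a single neighbour v in S, and Σ x ≥ 1 says S is non-empty: the feasible points
-- of MFF(G, 𝓕) are the indicator vectors of forts meeting the capacity
-- constraints of 𝓕.  Those constraints pass to subsets, so a proper subfort of
-- the support of an optimal x would be a feasible point of smaller weight.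
module Submission where

open import Defs hiding (sym)
open import Data.Nat using (ℕ; zero; suc; _+_; _≤_; _<_; z≤n; s≤s)
open import Data.Nat.Properties
  using (≤-refl; ≤-trans; ≤-reflexive; +-mono-≤; +-monoˡ-≤; <⇒≱; n≢0⇒n>0; +-commutativeSemigroup; module ≤-Reasoning)
import Data.Nat as ℕ
open import Algebra.Properties.CommutativeSemigroup +-commutativeSemigroup using (x∙yz≈y∙xz)
open import Data.Bool using (true; false; _∧_; not; if_then_else_)
open import Data.Fin using (Fin; zero; suc; _≟_)
open import Data.Fin.Subset using (Subset; _∈_; _∉_; _⊆_; _⊂_; Nonempty; ∣_∣)
open import Data.Fin.Subset.Properties using (∣⊥∣≡0; ⊥⊆; ∉⊥; p⊂q⇒∣p∣<∣q∣)
open import Data.List using (List; _∷_)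
open import Data.List.Relation.Unary.All using (All; _∷_)
import Data.List.Relation.Unary.All as All
open import Data.Product using (_,_; ∃; proj₁)
open import Data.Vec using ([]; _∷_)
open import Data.Vec.Properties using ([]=⇒lookup; lookup⇒[]=; lookup∘tabulate)
open import Function using (_∘_)
open import Relation.Binary.PropositionalEquality
  using (_≡_; _≢_; _≗_; refl; sym; trans; cong; cong₂; subst; module ≡-Reasoning)
open import Relation.Nullary using (¬_; contradiction)
open import Relation.Nullary.Decidable using (⌊_⌋; ⌊⌋-map′)

private
  variable
    n : ℕ

sumFin-cong : {f g : Fin n → ℕ} → f ≗ g → sumFin f ≡ sumFin g
sumFin-cong {zero}  f≗g = refl
sumFin-cong {suc n} f≗g = cong₂ _+_ (f≗g zero) (sumFin-cong (f≗g ∘ suc))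

sumFin-mono : {f g : Fin n → ℕ} → (∀ v → f v ≤ g v) → sumFin f ≤ sumFin g
sumFin-mono {zero}  f≤g = z≤n
sumFin-mono {suc n} f≤g = +-mono-≤ (f≤g zero) (sumFin-mono (f≤g ∘ suc))

sumFin>0⇒∃>0 : (f : Fin n → ℕ) → 0 < sumFin f → ∃ λ v → 0 < f v
sumFin>0⇒∃>0 {suc n} f pos with f zero in eq
... | suc _ = zero , subst (0 <_) (sym eq) (s≤s z≤n)
... | zero with sumFin>0⇒∃>0 (f ∘ suc) pos
...   | v , fv>0 = suc v , fv>0

sumFin-split : (f : Fin n → ℕ) (v : Fin n) →
               sumFin f ≡ f v + sumFin (λ w → if ⌊ w ≟ v ⌋ then 0 else f w)
sumFin-split f zero    = refl
sumFin-split f (suc v) = begin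
  f zero + sumFin (f ∘ suc)                ≡⟨ cong (f zero +_) (sumFin-split (f ∘ suc) v) ⟩
  f zero + (f (suc v) + rest)              ≡⟨ x∙yz≈y∙xz (f zero) (f (suc v)) rest ⟩
  f (suc v) + (f zero + rest)              ≡⟨ cong (λ s → f (suc v) + (f zero + s)) (sumFin-cong rest≗) ⟩
  f (suc v) + (f zero + sumFin (λ w → if ⌊ suc w ≟ suc v ⌋ then 0 else f (suc w))) ∎
  where
  open ≡-Reasoning
  rest : ℕ
  rest = sumFin (λ w → if ⌊ w ≟ v ⌋ then 0 else f (suc w))
  -- ⌊_⌋ does not compute through the map′ in Fin's _≟_.
  rest≗ : (λ w → if ⌊ w ≟ v ⌋ then 0 else f (suc w)) ≗ (λ w → if ⌊ suc w ≟ suc v ⌋ then 0 else f (suc w))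
  rest≗ w = cong (λ b → if b then 0 else f (suc w)) (sym (⌊⌋-map′ _ _ (w ≟ v)))

indicator : Subset n → Fin n → ℕ
indicator S v = [ v ∈ᵇ S ]

sumFin-indicator : (S : Subset n) → sumFin (indicator S) ≡ ∣ S ∣
sumFin-indicator []          = refl
sumFin-indicator (true ∷ S)  = cong suc (sumFin-indicator S)
sumFin-indicator (false ∷ S) = sumFin-indicator S

nonempty⇒∣p∣>0 : {p : Subset n} → Nonempty p → 0 < ∣ p ∣
nonempty⇒∣p∣>0 {n} {p} (v , v∈p) = subst (_< ∣ p ∣) (∣⊥∣≡0 n) (p⊂q⇒∣p∣<∣q∣ (⊥⊆ , v , v∈p , ∉⊥))

∈ᵇ⇒∈ : {v : Fin n} {S : Subset n} → v ∈ᵇ S ≡ true → v ∈ S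
∈ᵇ⇒∈ {v = v} {S} = lookup⇒[]= v S

indicator-binary : (S : Subset n) → Binary (indicator S)
indicator-binary S v with v ∈ᵇ S
... | true  = ≤-refl
... | false = z≤n

indicator-∉ : {v : Fin n} {S : Subset n} → v ∉ S → indicator S v ≡ 0
indicator-∉ {v = v} {S} v∉S with v ∈ᵇ S in eq
... | true  = contradiction (∈ᵇ⇒∈ eq) v∉S
... | false = refl

∈⇒indicator>0 : {v : Fin n} {S : Subset n} → v ∈ S → 0 < indicator S v
∈⇒indicator>0 v∈S = subst (λ b → 0 < [ b ]) (sym ([]=⇒lookup v∈S)) (s≤s z≤n)

indicator>0⇒∈ : {v : Fin n} {S : Subset n} → 0 < indicator S v → v ∈ S
indicator>0⇒∈ {v = v} {S} pos with v ∈ᵇ S in eq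
... | true = ∈ᵇ⇒∈ eq

indicator-mono : {S T : Subset n} → S ⊆ T → ∀ v → indicator S v ≤ indicator T v
indicator-mono {S = S} S⊆T v with v ∈ᵇ S in eq
... | false = z≤n
... | true  = ∈⇒indicator>0 (S⊆T (∈ᵇ⇒∈ eq))

bit≡[bit≟1] : {m : ℕ} → m ≤ 1 → m ≡ [ ⌊ m ℕ.≟ 1 ⌋ ]
bit≡[bit≟1] z≤n       = refl
bit≡[bit≟1] (s≤s z≤n) = refl

binary⇒≗indicator-support : {x : Fin n → ℕ} → Binary x → x ≗ indicator (support x)
binary⇒≗indicator-support {x = x} binary v =
  trans (bit≡[bit≟1] (binary v)) (cong [_] (sym (lookup∘tabulate (λ w → ⌊ x w ℕ.≟ 1 ⌋) v)))

binary⇒sumFin≡∣support∣ : {x : Fin n → ℕ} → Binary x → sumFin x ≡ ∣ support x ∣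
binary⇒sumFin≡∣support∣ {x = x} binary =
  trans (sumFin-cong (binary⇒≗indicator-support binary)) (sumFin-indicator (support x))

nbrSum : Graph n → (Fin n → ℕ) → Fin n → ℕ
nbrSum G x u = sumFin (λ w → if adj G u w then x w else 0)

nbrSum-split : (G : Graph n) (x : Fin n → ℕ) {u v : Fin n} → adj G u v ≡ true →
               nbrSum G x u ≡ x v + nbrSumExcept G x u v
nbrSum-split G x {u} {v} uv =
  trans (sumFin-split _ v) (cong₂ _+_ (cong (λ b → if b then x v else 0) uv) (sumFin-cong drop-v))
  where
  drop-v : (λ w → if ⌊ w ≟ v ⌋ then 0 else (if adj G u w then x w else 0))
         ≗ (λ w → if adj G u w ∧ not ⌊ w ≟ v ⌋ then x w else 0)
  drop-v w with adj G u w | ⌊ w ≟ v ⌋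
  ... | true  | true  = refl
  ... | true  | false = refl
  ... | false | true  = refl
  ... | false | false = refl

nbrCount≡nbrSum : (G : Graph n) (S : Subset n) {x : Fin n → ℕ} → x ≗ indicator S →
                  ∀ u → nbrCount G u S ≡ nbrSum G x u
nbrCount≡nbrSum G S {x} x≗S u = sumFin-cong pointwise
  where
  pointwise : (λ w → [ adj G u w ∧ (w ∈ᵇ S) ]) ≗ (λ w → if adj G u w then x w else 0)
  pointwise w with adj G u w
  ... | true  = sym (x≗S w)
  ... | false = refl

EdgeConstraints : Graph n → (Fin n → ℕ) → Set
EdgeConstraints G x = ∀ v u → adj G v u ≡ true → x v ≤ x u + nbrSumExcept G x u v

fort⇒edgeConstraints : (G : Graph n) {S : Subset n} → IsFort G S → EdgeConstraints G (indicator S)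
fort⇒edgeConstraints G {S} (_ , noLonely) v u vu with v ∈ᵇ S in v∈ᵇS | u ∈ᵇ S in u∈ᵇS
... | false | _     = z≤n
... | true  | true  = s≤s z≤n
... | true  | false = n≢0⇒n>0 λ rest≡0 → noLonely u u∉S (begin
  nbrCount G u S                                   ≡⟨ nbrCount≡nbrSum G S (λ _ → refl) u ⟩
  nbrSum G (indicator S) u                         ≡⟨ nbrSum-split G (indicator S) (trans (Graph.sym G u v) vu) ⟩
  indicator S v + nbrSumExcept G (indicator S) u v ≡⟨ cong₂ _+_ (cong [_] v∈ᵇS) rest≡0 ⟩
  1                                                ∎)
  where
  open ≡-Reasoning
  u∉S : u ∉ S
  u∉S u∈S = contradiction (trans (sym ([]=⇒lookup u∈S)) u∈ᵇS) λ ()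

edgeConstraints⇒fort : (G : Graph n) {x : Fin n → ℕ} {S : Subset n} →
                       Nonempty S → x ≗ indicator S → EdgeConstraints G x → IsFort G S
edgeConstraints⇒fort G {x} {S} nonempty x≗S edges = nonempty , noLonely
  where
  noLonely : ∀ u → u ∉ S → nbrCount G u S ≢ 1
  noLonely u u∉S count≡1 = lonely (sumFin>0⇒∃>0 _ (subst (0 <_) (sym sum≡1) (s≤s z≤n)))
    where
    sum≡1 : nbrSum G x u ≡ 1
    sum≡1 = trans (sym (nbrCount≡nbrSum G S x≗S u)) count≡1
    lonely : ¬ (∃ λ w → 0 < (if adj G u w then x w else 0))
    lonely (w , xw>0) with adj G u w in uw
    ... | true = contradiction (subst (2 ≤_) split≡1 (+-mono-≤ xw>0 (≤-trans xw>0 xw≤rest))) λ { (s≤s ()) }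
      where
      split≡1 : x w + nbrSumExcept G x u w ≡ 1
      split≡1 = trans (sym (nbrSum-split G x uw)) sum≡1
      xw≤rest : x w ≤ nbrSumExcept G x u w
      xw≤rest = subst (λ xu → x w ≤ xu + nbrSumExcept G x u w) (trans (x≗S u) (indicator-∉ u∉S))
                      (edges w u (trans (Graph.sym G w u) uw))

sumOver-mono : (F : Subset n) {x y : Fin n → ℕ} → (∀ v → x v ≤ y v) → sumOver F x ≤ sumOver F y
sumOver-mono F {x} {y} x≤y = sumFin-mono pointwise
  where
  pointwise : ∀ v → (if v ∈ᵇ F then x v else 0) ≤ (if v ∈ᵇ F then y v else 0)
  pointwise v with v ∈ᵇ F
  ... | true  = x≤y v
  ... | false = z≤n

module _ (G : Graph n) (𝓕 : List (Subset n)) where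

  feasible⇒fort : {x : Fin n → ℕ} → Feasible G 𝓕 x → IsFort G (support x)
  feasible⇒fort {x} (binary , sum>0 , edges , _) = edgeConstraints⇒fort G nonempty x≗S edges
    where
    x≗S : x ≗ indicator (support x)
    x≗S = binary⇒≗indicator-support binary
    nonempty : Nonempty (support x)
    nonempty with sumFin>0⇒∃>0 x sum>0
    ... | v , xv>0 = v , indicator>0⇒∈ (subst (0 <_) (x≗S v) xv>0)

  subfort-feasible : {x : Fin n → ℕ} {F′ : Subset n} →
                     Feasible G 𝓕 x → F′ ⊆ support x → IsFort G F′ → Feasible G 𝓕 (indicator F′)
  subfort-feasible {x} {F′} (binary , _ , _ , capacities) F′⊆S fort@(nonempty , _) =
      indicator-binary F′
    , subst (0 <_) (sym (sumFin-indicator F′)) (nonempty⇒∣p∣>0 nonempty)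
    , fort⇒edgeConstraints G fort
    , All.map (λ {F} → ≤-trans (+-monoˡ-≤ 1 (sumOver-mono F F′≤x))) capacities
    where
    F′≤x : ∀ v → indicator F′ v ≤ x v
    F′≤x v = ≤-trans (indicator-mono F′⊆S v) (≤-reflexive (sym (binary⇒≗indicator-support binary v)))

  optimal⇒minimalFort : {x : Fin n → ℕ} → Optimal G 𝓕 x → IsMinimalFort G (support x)
  optimal⇒minimalFort {x} (feasible@(binary , _) , optimal) = feasible⇒fort feasible , noSmallerFort
    where
    noSmallerFort : ∀ F′ → F′ ⊂ support x → ¬ IsFort G F′
    noSmallerFort F′ F′⊂S fort = <⇒≱ lighter (optimal _ (subfort-feasible feasible (proj₁ F′⊂S) fort))
      where
      open ≤-Reasoning
      lighter : sumFin (indicator F′) < sumFin x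
      lighter = begin-strict
        sumFin (indicator F′) ≡⟨ sumFin-indicator F′ ⟩
        ∣ F′ ∣                <⟨ p⊂q⇒∣p∣<∣q∣ F′⊂S ⟩
        ∣ support x ∣         ≡⟨ binary⇒sumFin≡∣support∣ binary ⟨
        sumFin x              ∎

theorem6p2 : (n : ℕ) (G : Graph n) (𝓕 : List (Subset n))
    → All (IsMinimalFort G) 𝓕
    → (x : Fin n → ℕ) → Optimal G 𝓕 x
    → All (IsMinimalFort G) (support x ∷ 𝓕)
theorem6p2 _ G 𝓕 minimalForts x optimal = optimal⇒minimalFort G 𝓕 optimal ∷ minimalForts
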